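{- $\mathbf P_{\mathrm{IS}}\subsetneq\mathcal{IS}_{br}/O(2^n)$.
   Context: Let $\mathbb B=\{\mathsf T,\mathsf F\}$. There are Boolean registers named $\mathtt{in}{:}i$ ($i\ge1$), $\mathtt{aux}{:}i$ ($i\ge1$) and $\mathtt{out}$, processing methods $\mathtt{set{:}T}$ (content becomes $\mathsf T$, reply $\mathsf T$), $\mathtt{set{:}F}$ (content becomes $\mathsf F$, reply $\mathsf F$), $\mathtt{get}$ (no change, reply is the content). Basic instructions are $f.m$ ($f$ register name, $m$ method). Primitive instructions: for each basic instruction $a$, the plain instruction $a$, positive test $+a$, negative test $-a$; forward jumps $\#l$ ($l\in\mathbb N$); termination $!$. An instruction sequence is a finite non-empty sequence $X=u_1;\dots;u_k$ of primitive instructions, $|X|=k$. Execution starts at $u_1$: $a$ executes $a$ and proceeds with the next instruction; $+a$ executes $a$ and proceeds with the next instruction if the reply is $\mathsf T$, otherwise skips the next instruction and proceeds with the one after; $-a$ likewise with reply roles reversed; $\#l$ proceeds with the $l$-th next instruction ($\#0$ causes inaction); $!$ terminates; if there is no instruction to proceed with, inaction occurs. $\mathcal{IS}_{br}$ is the set of instruction sequences whose basic instructions are all of the forms $\mathtt{in}{:}i.\mathtt{get}$, $\mathtt{aux}{:}i.\mathtt{get}$, $\mathtt{aux}{:}i.\mathtt{set{:}}b$, $\mathtt{out}.\mathtt{set{:}}b$ ($b\in\mathbb B$). $X$ computes $f:\mathbb B^n\to\mathbb B$ if for all $b_1,\dots,b_n$, executing $X$ with $\mathtt{in}{:}i$ initially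 $b_i$ ($i\le n$) and all auxiliary registers and $\mathtt{out}$ initially $\mathsf F$, execution never executes an instruction on $\mathtt{in}{:}i$ with $i>n$, ends by executing $!$, and leaves $f(b_1,\dots,b_n)$ in $\mathtt{out}$. A Boolean function family is a sequence $(f_n)_{n\in\mathbb N}$ with $f_n:\mathbb B^n\to\mathbb B$. For $\mathcal{IS}\subseteq\mathcal{IS}_{br}$ and a set $\mathcal F$ of functions $\mathbb N\to\mathbb N$, $\mathcal{IS}/\mathcal F$ is the class of Boolean function families $(f_n)$ for which there is $h\in\mathcal F$ such that for every $n$ some $X\in\mathcal{IS}$ computes $f_n$ with $|X|\le h(n)$. $\mathcal{IS}/O(g(n))$ denotes $\mathcal{IS}/\{h:\mathbb N\to\mathbb N\mid h(n)=O(g(n))\}$. $\mathrm{poly}$ is the set of polynomial functions $\mathbb N\to\mathbb N$, and $\mathbf P_{\mathrm{IS}}=\mathcal{IS}_{br}/\mathrm{poly}$. -}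

module Defs where

open import Data.Bool using (Bool; true; false; if_then_else_)
open import Data.Nat using (ℕ; zero; suc; _+_; _*_; _^_; _≤_; _<?_; _≡ᵇ_)
open import Data.List using (List; []; _∷_; drop)
open import Data.List.NonEmpty using (List⁺; toList) renaming (length to length⁺)
open import Data.Vec using (Vec; lookup)
open import Data.Fin using (fromℕ<)
open import Data.Product using (Σ; _×_; ∃)
open import Relation.Nullary using (yes; no; ¬_)
open import Relation.Binary.PropositionalEquality using (_≡_)

-- Basic instructions allowed in IS_br.
-- inGet i   : in:(i+1).get     (input registers are numbered from 1)
-- auxGet i  : aux:(i+1).get    (aux registers are numbered from 1)
-- auxSet i b: aux:(i+1).set:b
-- outSet b  : out.set:b
data Basic : Set where
  inGet  : ℕ → Basic
  auxGet : ℕ → Basic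
  auxSet : ℕ → Bool → Basic
  outSet : Bool → Basic

data Prim : Set where
  plain : Basic → Prim
  ptest : Basic → Prim
  ntest : Basic → Prim
  jump  : ℕ → Prim
  halt  : Prim

IS : Set
IS = List⁺ Prim

len : IS → ℕ
len = length⁺

record State : Set where
  constructor st
  field
    aux : ℕ → Bool
    out : Bool

initState : State
initState = st (λ _ → false) false

data Outcome : Set where
  terminated : Bool → Outcome
  inaction   : Outcome
  badInput   : Outcome         -- executed an instruction on in:i with i > n

data Step : Set where
  ok   : Bool → State → Step
  fail : Step

doBasic : ∀ {n} → Vec Bool n → Basic → State → Step
doBasic {n} bs (inGet i) s with suc i Data.Nat.≤? n
... | yes p = ok (lookup bs (fromℕ< p)) s
... | no _  = fail
doBasic bs (auxGet i) s = ok (State.aux s i) s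
doBasic bs (auxSet i b) (st a o) = ok b (st (λ j → if j ≡ᵇ i then b else a j) o)
doBasic bs (outSet b) (st a o) = ok b (st a b)

-- Execution of the remaining instructions u_j ; u_{j+1} ; ... (the list starts
-- at the current instruction).  Every step strictly shortens the remaining
-- list, so fuel equal to the length of the list suffices.
exec : ∀ {n} → Vec Bool n → ℕ → List Prim → State → Outcome
exec bs zero _ _ = inaction
exec bs (suc k) [] s = inaction
exec bs (suc k) (halt ∷ rest) s = terminated (State.out s)
exec bs (suc k) (jump zero ∷ rest) s = inaction
exec bs (suc k) (jump (suc l) ∷ rest) s = exec bs k (drop l rest) s
exec bs (suc k) (plain a ∷ rest) s with doBasic bs a s
... | ok _ s' = exec bs k rest s'
... | fail = badInput
exec bs (suc k) (ptest a ∷ rest) s with doBasic bs a s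
... | ok true s' = exec bs k rest s'
... | ok false s' = exec bs k (drop 1 rest) s'
... | fail = badInput
exec bs (suc k) (ntest a ∷ rest) s with doBasic bs a s
... | ok false s' = exec bs k rest s'
... | ok true s' = exec bs k (drop 1 rest) s'
... | fail = badInput

run : ∀ {n} → IS → Vec Bool n → Outcome
run X bs = exec bs (len X) (toList X) initState

Computes : (n : ℕ) → IS → (Vec Bool n → Bool) → Set
Computes n X f = (bs : Vec Bool n) → run X bs ≡ terminated (f bs)

Family : Set
Family = (n : ℕ) → Vec Bool n → Bool

InClass : ((ℕ → ℕ) → Set) → Family → Set
InClass F fam = Σ (ℕ → ℕ) λ h → F h × ((n : ℕ) → Σ IS λ X → len X ≤ h n × Computes n X (fam n))

evalPoly : List ℕ → ℕ → ℕ
evalPoly [] n = 0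
evalPoly (c ∷ cs) n = c + n * evalPoly cs n

IsPoly : (ℕ → ℕ) → Set
IsPoly h = Σ (List ℕ) λ cs → (n : ℕ) → h n ≡ evalPoly cs n

IsO2^n : (ℕ → ℕ) → Set
IsO2^n h = Σ ℕ λ c → Σ ℕ λ N → (n : ℕ) → N ≤ n → h n ≤ c * 2 ^ n

P-IS : Family → Set
P-IS = InClass IsPoly

IS-O2^n : Family → Set
IS-O2^n = InClass IsO2^n

_⊊_ : (Family → Set) → (Family → Set) → Set
A ⊊ B = ((f : Family) → A f → B f) × (Σ Family λ f → B f × ¬ A f)

-- Every Boolean function on n inputs is computed by its decision tree, a
-- program of length 4·2^n − 2, so every family lies in IS_br/O(2^n).
-- Conversely, a program of length at most L can be normalised, without
-- changing what it computes, into a word of length at most L over an alphabet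
-- of O(n + L) instructions: auxiliary registers are renumbered by their first
-- occurrence, and input indices beyond n and jump lengths beyond L are cut
-- down to harmless ones. So at most O(n + L)^L functions of n inputs have such
-- programs. For L = 2^⌊n/2⌋ this is fewer than the 2^(2^n) truth tables, so for
-- every n some function escapes; the resulting family is not in P_IS because
-- 2^⌊n/2⌋ eventually exceeds every polynomial.
module Submission where

open import Defs
open import Data.Bool using (Bool; true; false; if_then_else_)
open import Data.Nat
open import Data.Nat.Properties
open import Data.Nat.ListAction using (sum)
open import Data.Nat.Tactic.RingSolver using (solve-∀)
open import Data.List using (List; []; _∷_; _++_; drop; length; map; upTo; concatMap; cartesianProductWith)
open import Data.List.Properties
  using (++-assoc; ++-identityʳ; length-++; length-map; length-upTo; length-drop; drop-map; drop-all)
open import Data.List.NonEmpty using (List⁺; _∷_; toList)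
open import Data.List.Membership.Propositional using (_∈_; _∉_)
open import Data.List.Membership.Propositional.Properties
  using (∈-++⁺ˡ; ∈-++⁺ʳ; ∈-map⁺; ∈-upTo⁺; ∈-cartesianProductWith⁺)
open import Data.List.Relation.Binary.Subset.Propositional using (_⊆_)
open import Data.List.Relation.Unary.Any using (here; there)
open import Data.List.Relation.Unary.All as All using (All; []; _∷_)
import Data.List.Relation.Unary.All.Properties as All
open import Data.Vec as Vec using (Vec; []; _∷_; lookup)
open import Data.Vec.Properties using (take++drop≡id)
open import Data.Fin using (fromℕ<)
open import Data.Product using (∃-syntax; _×_; _,_; proj₁; proj₂)
open import Data.Sum using (inj₁; inj₂)
open import Function using (_∘_)
open import Relation.Nullary using (¬_; yes; no; contradiction)
open import Relation.Nullary.Decidable using (dec-true; dec-false)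
open import Relation.Binary.PropositionalEquality

-- Input registers and decision trees

input : ∀ {n} → Vec Bool n → ℕ → Bool
input []       _       = false
input (b ∷ _)  zero    = b
input (_ ∷ bs) (suc i) = input bs i

lookup-fromℕ< : ∀ {n i} (bs : Vec Bool n) (i<n : i < n) → lookup bs (fromℕ< i<n) ≡ input bs i
lookup-fromℕ< {i = zero}  (b ∷ bs) _         = refl
lookup-fromℕ< {i = suc i} (b ∷ bs) (s≤s i<n) = lookup-fromℕ< bs i<n

module _ {n} (bs : Vec Bool n) (s : State) where

  doBasic-inGet-< : ∀ {i} → i < n → doBasic bs (inGet i) s ≡ ok (input bs i) s
  doBasic-inGet-< {i} i<n with suc i ≤? n
  ... | yes i<n′ = cong (λ b → ok b s) (lookup-fromℕ< bs i<n′)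
  ... | no  i≮n  = contradiction i<n i≮n

  doBasic-inGet-≥ : ∀ {i} → n ≤ i → doBasic bs (inGet i) s ≡ fail
  doBasic-inGet-≥ {i} n≤i with suc i ≤? n
  ... | yes i<n = contradiction i<n (≤⇒≯ n≤i)
  ... | no  _   = refl

window : ∀ {n} → Vec Bool n → ℕ → (k : ℕ) → Vec Bool k
window bs j zero    = []
window bs j (suc k) = input bs j ∷ window bs (suc j) k

window-∷ : ∀ {n} b (bs : Vec Bool n) j k → window (b ∷ bs) (suc j) k ≡ window bs j k
window-∷ b bs j zero    = refl
window-∷ b bs j (suc k) = cong (input bs j ∷_) (window-∷ b bs (suc j) k)

window-whole : ∀ {n} (bs : Vec Bool n) → window bs 0 n ≡ bs
window-whole []       = refl
window-whole (b ∷ bs) = cong (b ∷_) (trans (window-∷ b bs 0 _) (window-whole bs))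

drop-length-++ : ∀ {A : Set} (xs ys : List A) → drop (length xs) (xs ++ ys) ≡ ys
drop-length-++ []       ys = refl
drop-length-++ (x ∷ xs) ys = drop-length-++ xs ys

treeSize : ℕ → ℕ
treeSize zero    = 2
treeSize (suc k) = 2 + (treeSize k + treeSize k)

2+treeSize : ∀ k → 2 + treeSize k ≡ 4 * 2 ^ k
2+treeSize zero    = refl
2+treeSize (suc k) = begin
  2 + treeSize (suc k)                ≡⟨ double (treeSize k) ⟩
  (2 + treeSize k) + (2 + treeSize k) ≡⟨ cong₂ _+_ (2+treeSize k) (2+treeSize k) ⟩
  4 * 2 ^ k + 4 * 2 ^ k               ≡⟨ quadruple (2 ^ k) ⟩
  4 * 2 ^ suc k                       ∎
  where
  open ≡-Reasoning
  double : ∀ t → 2 + (2 + (t + t)) ≡ (2 + t) + (2 + t)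
  double = solve-∀
  quadruple : ∀ x → 4 * x + 4 * x ≡ 4 * (2 * x)
  quadruple = solve-∀

-- A false reply to the test of in:(j+1) reaches the jump, which skips the
-- subtree for a true reply.
decisionTree : ℕ → (k : ℕ) → (Vec Bool k → Bool) → List⁺ Prim
decisionTree j zero    g = plain (outSet (g [])) ∷ halt ∷ []
decisionTree j (suc k) g =
  ntest (inGet j) ∷ jump (suc (treeSize k)) ∷
    toList (decisionTree (suc j) k (g ∘ (true ∷_))) ++ toList (decisionTree (suc j) k (g ∘ (false ∷_)))

length-decisionTree : ∀ j k g → length (toList (decisionTree j k g)) ≡ treeSize k
length-decisionTree j zero    g = refl
length-decisionTree j (suc k) g = cong (2 +_) (trans
  (length-++ (toList (decisionTree (suc j) k (g ∘ (true ∷_)))))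
  (cong₂ _+_ (length-decisionTree (suc j) k _) (length-decisionTree (suc j) k _)))

drop-decisionTree : ∀ {j k g} ys → drop (treeSize k) (toList (decisionTree j k g) ++ ys) ≡ ys
drop-decisionTree {j} {k} {g} ys = begin
  drop (treeSize k) (T ++ ys)  ≡⟨ cong (λ l → drop l (T ++ ys)) (sym (length-decisionTree j k g)) ⟩
  drop (length T) (T ++ ys)    ≡⟨ drop-length-++ T ys ⟩
  ys                           ∎
  where
  open ≡-Reasoning
  T = toList (decisionTree j k g)

exec-decisionTree : ∀ {n} (bs : Vec Bool n) j k g rest fuel s → j + k ≤ n → treeSize k ≤ fuel →
  exec bs fuel (toList (decisionTree j k g) ++ rest) s ≡ terminated (g (window bs j k))
exec-decisionTree bs j zero g rest (suc (suc fuel)) s _ _ = refl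
exec-decisionTree bs j zero g rest (suc zero) s _ (s≤s ())
exec-decisionTree {n} bs j (suc k) g rest (suc (suc fuel)) s j+1+k≤n (s≤s (s≤s 2size≤fuel))
  rewrite doBasic-inGet-< bs s (m+n≤o⇒m≤o (suc j) (subst (_≤ n) (+-suc j k) j+1+k≤n))
        | ++-assoc (toList (decisionTree (suc j) k (g ∘ (true ∷_))))
                   (toList (decisionTree (suc j) k (g ∘ (false ∷_)))) rest
  with input bs j
... | true  = exec-decisionTree bs (suc j) k _ _ (suc fuel) s 1+j+k≤n (m≤n⇒m≤1+n (m+n≤o⇒m≤o _ 2size≤fuel))
  where 1+j+k≤n = subst (_≤ n) (+-suc j k) j+1+k≤n
... | false
  rewrite drop-decisionTree {suc j} {k} {g ∘ (true ∷_)} (toList (decisionTree (suc j) k (g ∘ (false ∷_))) ++ rest)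
  = exec-decisionTree bs (suc j) k _ _ fuel s 1+j+k≤n (m+n≤o⇒n≤o _ 2size≤fuel)
  where 1+j+k≤n = subst (_≤ n) (+-suc j k) j+1+k≤n

len≡length-toList : (X : IS) → len X ≡ length (toList X)
len≡length-toList (_ ∷ _) = refl

len-decisionTree : ∀ n f → len (decisionTree 0 n f) ≡ treeSize n
len-decisionTree n f = trans (len≡length-toList (decisionTree 0 n f)) (length-decisionTree 0 n f)

decisionTree-computes : ∀ n f → Computes n (decisionTree 0 n f) f
decisionTree-computes n f bs = begin
  exec bs (len X) (toList X) initState        ≡⟨ cong (λ xs → exec bs (len X) xs initState)
                                                     (sym (++-identityʳ (toList X))) ⟩
  exec bs (len X) (toList X ++ []) initState  ≡⟨ exec-decisionTree bs 0 n f [] (len X) initState ≤-refl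
                                                   (≤-reflexive (sym (len-decisionTree n f))) ⟩
  terminated (f (window bs 0 n))              ≡⟨ cong (terminated ∘ f) (window-whole bs) ⟩
  terminated (f bs)                           ∎
  where
  open ≡-Reasoning
  X = decisionTree 0 n f

IS-O2^n-universal : (fam : Family) → IS-O2^n fam
IS-O2^n-universal fam = (λ n → 4 * 2 ^ n) , (4 , 0 , λ _ _ → ≤-refl) ,
  λ n → decisionTree 0 n (fam n) ,
        ≤-trans (≤-reflexive (len-decisionTree n (fam n)))
                (≤-trans (m≤n+m _ 2) (≤-reflexive (2+treeSize n))) ,
        decisionTree-computes n (fam n)

-- Truth tables and counting

Table : ℕ → Set
Table n = Vec Bool (2 ^ n)

toTable : ∀ n → (Vec Bool n → Bool) → Table n
toTable zero    f = f [] ∷ []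
toTable (suc n) f = toTable n (f ∘ (true ∷_)) Vec.++ toTable n (f ∘ (false ∷_)) Vec.++ []

fromTable : ∀ n → Table n → Vec Bool n → Bool
fromTable zero    (b ∷ []) []           = b
fromTable (suc n) t        (true  ∷ bs) = fromTable n (Vec.take (2 ^ n) t) bs
fromTable (suc n) t        (false ∷ bs) = fromTable n (Vec.take (2 ^ n) (Vec.drop (2 ^ n) t)) bs

toTable-cong : ∀ n {f g : Vec Bool n → Bool} → (∀ bs → f bs ≡ g bs) → toTable n f ≡ toTable n g
toTable-cong zero    f≗g = cong (_∷ []) (f≗g [])
toTable-cong (suc n) f≗g = cong₂ (λ u v → u Vec.++ v Vec.++ [])
  (toTable-cong n (f≗g ∘ (true ∷_))) (toTable-cong n (f≗g ∘ (false ∷_)))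

toTable-fromTable : ∀ n (t : Table n) → toTable n (fromTable n t) ≡ t
toTable-fromTable zero    (b ∷ []) = refl
toTable-fromTable (suc n) t        = begin
  toTable n (fromTable n (Vec.take x t)) Vec.++ toTable n (fromTable n (Vec.take x (Vec.drop x t))) Vec.++ []
    ≡⟨ cong₂ (λ u v → u Vec.++ v Vec.++ []) (toTable-fromTable n _) (toTable-fromTable n _) ⟩
  Vec.take x t Vec.++ Vec.take x (Vec.drop x t) Vec.++ []
    ≡⟨ cong (Vec.take x t Vec.++_) (take++[] (Vec.drop x t)) ⟩
  Vec.take x t Vec.++ Vec.drop x t
    ≡⟨ take++drop≡id x t ⟩
  t ∎
  where
  open ≡-Reasoning
  x = 2 ^ n
  take++[] : (u : Vec Bool (x + 0)) → Vec.take x u Vec.++ [] ≡ u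
  take++[] u with Vec.drop x u | take++drop≡id x u
  ... | [] | eq = eq

tailsWithHead : ∀ {k} → Bool → List (Vec Bool (suc k)) → List (Vec Bool k)
tailsWithHead b     []                  = []
tailsWithHead true  ((true  ∷ v) ∷ vs) = v ∷ tailsWithHead true vs
tailsWithHead true  ((false ∷ _) ∷ vs) = tailsWithHead true vs
tailsWithHead false ((true  ∷ _) ∷ vs) = tailsWithHead false vs
tailsWithHead false ((false ∷ v) ∷ vs) = v ∷ tailsWithHead false vs

length-tailsWithHead : ∀ {k} (vs : List (Vec Bool (suc k))) →
  length (tailsWithHead true vs) + length (tailsWithHead false vs) ≡ length vs
length-tailsWithHead []                 = refl
length-tailsWithHead ((true  ∷ _) ∷ vs) = cong suc (length-tailsWithHead vs)
length-tailsWithHead ((false ∷ _) ∷ vs) = trans (+-suc _ _) (cong suc (length-tailsWithHead vs))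

∈-tailsWithHead : ∀ {k} b {v : Vec Bool k} {vs} → (b ∷ v) ∈ vs → v ∈ tailsWithHead b vs
∈-tailsWithHead true  {vs = (true  ∷ _) ∷ _}  (here refl) = here refl
∈-tailsWithHead false {vs = (false ∷ _) ∷ _}  (here refl) = here refl
∈-tailsWithHead true  {vs = (true  ∷ _) ∷ _}  (there v∈) = there (∈-tailsWithHead true v∈)
∈-tailsWithHead true  {vs = (false ∷ _) ∷ _}  (there v∈) = ∈-tailsWithHead true v∈
∈-tailsWithHead false {vs = (true  ∷ _) ∷ _}  (there v∈) = ∈-tailsWithHead false v∈
∈-tailsWithHead false {vs = (false ∷ _) ∷ _}  (there v∈) = there (∈-tailsWithHead false v∈)

-- Fewer than 2^k vectors: the first bit is chosen so that fewer than 2^(k-1) of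
-- the vectors start with it.
avoid : ∀ k → List (Vec Bool k) → Vec Bool k
avoid zero    vs = []
avoid (suc k) vs with length (tailsWithHead true vs) <? 2 ^ k
... | yes _ = true  ∷ avoid k (tailsWithHead true vs)
... | no  _ = false ∷ avoid k (tailsWithHead false vs)

avoid-∉ : ∀ k {vs} → length vs < 2 ^ k → avoid k vs ∉ vs
avoid-∉ zero    {[]}    _        ()
avoid-∉ zero    {_ ∷ _} (s≤s ()) _
avoid-∉ (suc k) {vs} vs<2^k+1 ∈vs with length (tailsWithHead true vs) <? 2 ^ k
... | yes few-true = avoid-∉ k few-true (∈-tailsWithHead true ∈vs)
... | no  many-true = avoid-∉ k few-false (∈-tailsWithHead false ∈vs)
  where
  #true  = length (tailsWithHead true vs)
  #false = length (tailsWithHead false vs)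
  few-false : #false < 2 ^ k
  few-false = +-cancelˡ-< #true #false (2 ^ k) (begin-strict
    #true + #false  ≡⟨ length-tailsWithHead vs ⟩
    length vs       <⟨ vs<2^k+1 ⟩
    2 ^ k + (2 ^ k + 0) ≡⟨ cong (2 ^ k +_) (+-identityʳ (2 ^ k)) ⟩
    2 ^ k + 2 ^ k   ≤⟨ +-monoˡ-≤ (2 ^ k) (≮⇒≥ many-true) ⟩
    #true + 2 ^ k   ∎)
    where open ≤-Reasoning

lists≤ : ∀ {A : Set} → List A → ℕ → List (List A)
lists≤ as zero    = [] ∷ []
lists≤ as (suc L) = [] ∷ cartesianProductWith _∷_ as (lists≤ as L)

∈-lists≤ : ∀ {A : Set} {as : List A} {xs} L → All (_∈ as) xs → length xs ≤ L → xs ∈ lists≤ as L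
∈-lists≤ zero    []           _          = here refl
∈-lists≤ (suc L) []           _          = here refl
∈-lists≤ (suc L) (x∈ ∷ xs∈) (s≤s |xs|≤L) =
  there (∈-cartesianProductWith⁺ _∷_ x∈ (∈-lists≤ L xs∈ |xs|≤L))

length-cartesianProductWith : ∀ {A B C : Set} (f : A → B → C) xs ys →
  length (cartesianProductWith f xs ys) ≡ length xs * length ys
length-cartesianProductWith f []       ys = refl
length-cartesianProductWith f (x ∷ xs) ys = trans (length-++ (map (f x) ys))
  (cong₂ _+_ (length-map (f x) ys) (length-cartesianProductWith f xs ys))

length-lists≤ : ∀ {A : Set} (as : List A) L → length (lists≤ as L) ≤ suc (length as) ^ L
length-lists≤ as zero    = ≤-refl
length-lists≤ as (suc L) = begin
  suc (length (cartesianProductWith _∷_ as (lists≤ as L))) ≡⟨ cong suc (length-cartesianProductWith _∷_ as _) ⟩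
  1 + length as * length (lists≤ as L)                      ≤⟨ +-mono-≤ (m^n>0 (suc (length as)) L)
                                                                        (*-monoʳ-≤ (length as) (length-lists≤ as L)) ⟩
  suc (length as) ^ L + length as * suc (length as) ^ L     ∎
  where open ≤-Reasoning

-- Normal forms of programs

indexOf : List ℕ → ℕ → ℕ
indexOf []       i = 0
indexOf (x ∷ xs) i with x ≟ i
... | yes _ = 0
... | no  _ = suc (indexOf xs i)

nth : List ℕ → ℕ → ℕ
nth []       _       = 0
nth (x ∷ _)  zero    = x
nth (_ ∷ xs) (suc k) = nth xs k

indexOf-< : ∀ {i xs} → i ∈ xs → indexOf xs i < length xs
indexOf-< {i} {x ∷ xs} i∈ with x ≟ i
... | yes _ = s≤s z≤n
... | no x≢i with i∈
...   | here refl  = contradiction refl x≢i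
...   | there i∈xs = s≤s (indexOf-< i∈xs)

nth-indexOf : ∀ {i xs} → i ∈ xs → nth xs (indexOf xs i) ≡ i
nth-indexOf {i} {x ∷ xs} i∈ with x ≟ i
... | yes x≡i = x≡i
... | no x≢i with i∈
...   | here refl  = contradiction refl x≢i
...   | there i∈xs = nth-indexOf i∈xs

indexOf-injective : ∀ {xs i j} → i ∈ xs → j ∈ xs → indexOf xs i ≡ indexOf xs j → i ≡ j
indexOf-injective {xs} i∈ j∈ eq = trans (sym (nth-indexOf i∈)) (trans (cong (nth xs) eq) (nth-indexOf j∈))

-- (m ≡ᵇ n) is definitionally does (m ≟ n).
≡ᵇ-indexOf : ∀ {xs i j} → i ∈ xs → j ∈ xs → (indexOf xs j ≡ᵇ indexOf xs i) ≡ (j ≡ᵇ i)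
≡ᵇ-indexOf {xs} {i} {j} i∈ j∈ with j ≟ i
... | yes refl = trans (dec-true (indexOf xs j ≟ indexOf xs j) refl)
                       (sym (dec-true (j ≟ j) refl))
... | no  j≢i  = trans (dec-false (indexOf xs j ≟ indexOf xs i) (j≢i ∘ indexOf-injective j∈ i∈))
                       (sym (dec-false (j ≟ i) j≢i))

auxRegister : Basic → List ℕ
auxRegister (inGet _)    = []
auxRegister (auxGet i)   = i ∷ []
auxRegister (auxSet i _) = i ∷ []
auxRegister (outSet _)   = []

auxRegisters : Prim → List ℕ
auxRegisters (plain a) = auxRegister a
auxRegisters (ptest a) = auxRegister a
auxRegisters (ntest a) = auxRegister a
auxRegisters (jump _)  = []
auxRegisters halt      = []

length-auxRegister : ∀ a → length (auxRegister a) ≤ 1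
length-auxRegister (inGet _)    = z≤n
length-auxRegister (auxGet _)   = ≤-refl
length-auxRegister (auxSet _ _) = ≤-refl
length-auxRegister (outSet _)   = z≤n

length-auxRegisters : ∀ u → length (auxRegisters u) ≤ 1
length-auxRegisters (plain a) = length-auxRegister a
length-auxRegisters (ptest a) = length-auxRegister a
length-auxRegisters (ntest a) = length-auxRegister a
length-auxRegisters (jump _)  = z≤n
length-auxRegisters halt      = z≤n

length-concatMap-auxRegisters : ∀ us → length (concatMap auxRegisters us) ≤ length us
length-concatMap-auxRegisters []       = z≤n
length-concatMap-auxRegisters (u ∷ us) = ≤-trans (≤-reflexive (length-++ (auxRegisters u)))
  (+-mono-≤ (length-auxRegisters u) (length-concatMap-auxRegisters us))

auxRegisters-⊆ : ∀ us → All (λ u → auxRegisters u ⊆ concatMap auxRegisters us) us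
auxRegisters-⊆ []       = []
auxRegisters-⊆ (u ∷ us) =
  ∈-++⁺ˡ ∷ All.map (λ ⊆us {i} → ∈-++⁺ʳ (auxRegisters u) ∘ ⊆us {i}) (auxRegisters-⊆ us)

-- S lists the auxiliary registers in use and L bounds the program length.
-- Register aux:(i+1) becomes aux:(indexOf S i + 1); an input in:(i+1) with
-- i ≥ n becomes in:(n+1), which fails just the same; a jump beyond the end
-- becomes a jump by L+1, which causes inaction just the same.
normalizeBasic : ℕ → List ℕ → Basic → Basic
normalizeBasic n S (inGet i)    = inGet (i ⊓ n)
normalizeBasic n S (auxGet i)   = auxGet (indexOf S i)
normalizeBasic n S (auxSet i b) = auxSet (indexOf S i) b
normalizeBasic n S (outSet b)   = outSet b

normalize : ℕ → ℕ → List ℕ → Prim → Prim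
normalize n L S (plain a) = plain (normalizeBasic n S a)
normalize n L S (ptest a) = ptest (normalizeBasic n S a)
normalize n L S (ntest a) = ntest (normalizeBasic n S a)
normalize n L S (jump l)  = jump (l ⊓ suc L)
normalize n L S halt      = halt

Renamed : List ℕ → State → State → Set
Renamed S s s′ = State.out s′ ≡ State.out s × (∀ {i} → i ∈ S → State.aux s′ (indexOf S i) ≡ State.aux s i)

data Corresponding (S : List ℕ) : Step → Step → Set where
  both-fail : Corresponding S fail fail
  both-ok   : ∀ r {t t′} → Renamed S t t′ → Corresponding S (ok r t) (ok r t′)

drop-⊓ : ∀ {A : Set} {L} l (xs : List A) → length xs ≤ L → drop (l ⊓ L) xs ≡ drop l xs
drop-⊓ {L = L} l xs |xs|≤L with ≤-total l L
... | inj₁ l≤L rewrite m≤n⇒m⊓n≡m l≤L = refl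
... | inj₂ L≤l rewrite m≥n⇒m⊓n≡n L≤l =
  trans (drop-all L xs |xs|≤L) (sym (drop-all l xs (≤-trans |xs|≤L L≤l)))

length-drop-≤ : ∀ {A : Set} l (xs : List A) → length (drop l xs) ≤ length xs
length-drop-≤ l xs = ≤-trans (≤-reflexive (length-drop l xs)) (m∸n≤m (length xs) l)

module _ {n} (bs : Vec Bool n) (S : List ℕ) where

  doBasic-inGet-⊓ : ∀ i s → doBasic bs (inGet (i ⊓ n)) s ≡ doBasic bs (inGet i) s
  doBasic-inGet-⊓ i s with n ≤? i
  ... | yes n≤i rewrite m≥n⇒m⊓n≡n n≤i =
    trans (doBasic-inGet-≥ bs s ≤-refl) (sym (doBasic-inGet-≥ bs s n≤i))
  ... | no  n≰i rewrite m≤n⇒m⊓n≡m (<⇒≤ (≰⇒> n≰i)) = refl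

  inGet-corresponding : ∀ i {s s′} → Renamed S s s′ →
    Corresponding S (doBasic bs (inGet i) s) (doBasic bs (inGet i) s′)
  inGet-corresponding i r with suc i ≤? n
  ... | yes _ = both-ok _ r
  ... | no  _ = both-fail

  normalizeBasic-corresponding : ∀ a {s s′} → auxRegister a ⊆ S → Renamed S s s′ →
    Corresponding S (doBasic bs a s) (doBasic bs (normalizeBasic n S a) s′)
  normalizeBasic-corresponding (inGet i) {s′ = s′} _ r =
    subst (Corresponding S _) (sym (doBasic-inGet-⊓ i s′)) (inGet-corresponding i r)
  normalizeBasic-corresponding (auxGet i) a⊆S r rewrite proj₂ r (a⊆S (here refl)) = both-ok _ r
  normalizeBasic-corresponding (auxSet i b) {st a o} {st a′ o′} a⊆S (o≡ , a≡) = both-ok b (o≡ , a≡′)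
    where
    a≡′ : ∀ {j} → j ∈ S →
          (if indexOf S j ≡ᵇ indexOf S i then b else a′ (indexOf S j)) ≡ (if j ≡ᵇ i then b else a j)
    a≡′ {j} j∈ rewrite ≡ᵇ-indexOf (a⊆S (here refl)) j∈ with j ≡ᵇ i
    ... | true  = refl
    ... | false = a≡ j∈
  normalizeBasic-corresponding (outSet b) _ (_ , a≡) = both-ok b (refl , a≡)

  module _ (L : ℕ) where

    exec-normalize : ∀ fuel us {s s′} →
      All (λ u → auxRegisters u ⊆ S) us → length us ≤ L → Renamed S s s′ →
      exec bs fuel (map (normalize n L S) us) s′ ≡ exec bs fuel us s

    exec-normalize-drop : ∀ fuel l us {s s′} →
      All (λ u → auxRegisters u ⊆ S) us → length us ≤ L → Renamed S s s′ →
      exec bs fuel (drop l (map (normalize n L S) us)) s′ ≡ exec bs fuel (drop l us) s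
    exec-normalize-drop fuel l us us⊆ |us|≤L r = trans (cong (λ vs → exec bs fuel vs _) (drop-map l us))
      (exec-normalize fuel (drop l us) (All.drop⁺ l us⊆) (≤-trans (length-drop-≤ l us) |us|≤L) r)

    exec-normalize zero       us                  _          _      _ = refl
    exec-normalize (suc fuel) []                  _          _      _ = refl
    exec-normalize (suc fuel) (halt ∷ us)         _          _      r = cong terminated (proj₁ r)
    exec-normalize (suc fuel) (jump zero ∷ us)    _          _      _ = refl
    exec-normalize (suc fuel) (jump (suc l) ∷ us) (_ ∷ us⊆) |us|<L r = trans
      (cong (λ vs → exec bs fuel vs _) (drop-⊓ l _ (≤-trans (≤-reflexive (length-map _ us)) (<⇒≤ |us|<L))))
      (exec-normalize-drop fuel l us us⊆ (<⇒≤ |us|<L) r)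
    exec-normalize (suc fuel) (plain a ∷ us) {s} {s′} (a⊆ ∷ us⊆) |us|<L r
      with doBasic bs a s | doBasic bs (normalizeBasic n S a) s′ | normalizeBasic-corresponding a {s} {s′} a⊆ r
    ... | _ | _ | both-fail        = refl
    ... | _ | _ | both-ok _ r′     = exec-normalize fuel us us⊆ (<⇒≤ |us|<L) r′
    exec-normalize (suc fuel) (ptest a ∷ us) {s} {s′} (a⊆ ∷ us⊆) |us|<L r
      with doBasic bs a s | doBasic bs (normalizeBasic n S a) s′ | normalizeBasic-corresponding a {s} {s′} a⊆ r
    ... | _ | _ | both-fail        = refl
    ... | _ | _ | both-ok true r′  = exec-normalize fuel us us⊆ (<⇒≤ |us|<L) r′
    ... | _ | _ | both-ok false r′ = exec-normalize-drop fuel 1 us us⊆ (<⇒≤ |us|<L) r′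
    exec-normalize (suc fuel) (ntest a ∷ us) {s} {s′} (a⊆ ∷ us⊆) |us|<L r
      with doBasic bs a s | doBasic bs (normalizeBasic n S a) s′ | normalizeBasic-corresponding a {s} {s′} a⊆ r
    ... | _ | _ | both-fail        = refl
    ... | _ | _ | both-ok false r′ = exec-normalize fuel us us⊆ (<⇒≤ |us|<L) r′
    ... | _ | _ | both-ok true r′  = exec-normalize-drop fuel 1 us us⊆ (<⇒≤ |us|<L) r′

basicAlphabet : ℕ → ℕ → List Basic
basicAlphabet n L =
  map inGet (upTo (suc n)) ++ map auxGet (upTo L) ++ map (λ i → auxSet i true) (upTo L) ++
  map (λ i → auxSet i false) (upTo L) ++ outSet true ∷ outSet false ∷ []

alphabet : ℕ → ℕ → List Prim
alphabet n L =
  map plain (basicAlphabet n L) ++ map ptest (basicAlphabet n L) ++ map ntest (basicAlphabet n L) ++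
  map jump (upTo (2 + L)) ++ halt ∷ []

length-map-++ : ∀ {A B : Set} (f : A → B) xs {ys} → length (map f xs ++ ys) ≡ length xs + length ys
length-map-++ f xs = trans (length-++ (map f xs)) (cong (_+ _) (length-map f xs))

length-map-upTo-++ : ∀ {B : Set} (f : ℕ → B) k {ys} → length (map f (upTo k) ++ ys) ≡ k + length ys
length-map-upTo-++ f k = trans (length-map-++ f (upTo k)) (cong (_+ _) (length-upTo k))

length-basicAlphabet : ∀ n L → length (basicAlphabet n L) ≡ suc n + (L + (L + (L + 2)))
length-basicAlphabet n L = trans (length-map-upTo-++ inGet (suc n)) (cong (suc n +_)
  (trans (length-map-upTo-++ auxGet L) (cong (L +_)
  (trans (length-map-upTo-++ _ L) (cong (L +_) (length-map-upTo-++ _ L))))))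

length-alphabet : ∀ n L → length (alphabet n L) ≡ 3 * n + 10 * L + 12
length-alphabet n L = begin
  length (alphabet n L)           ≡⟨ layout ⟩
  B + (B + (B + (2 + L + 1)))     ≡⟨ cong (λ B → B + (B + (B + (2 + L + 1)))) (length-basicAlphabet n L) ⟩
  B′ + (B′ + (B′ + (2 + L + 1)))  ≡⟨ simplify n L ⟩
  3 * n + 10 * L + 12             ∎
  where
  open ≡-Reasoning
  B = length (basicAlphabet n L)
  B′ = suc n + (L + (L + (L + 2)))
  layout : length (alphabet n L) ≡ B + (B + (B + (2 + L + 1)))
  layout = trans (length-map-++ plain (basicAlphabet n L)) (cong (B +_)
    (trans (length-map-++ ptest (basicAlphabet n L)) (cong (B +_)
    (trans (length-map-++ ntest (basicAlphabet n L)) (cong (B +_) (length-map-upTo-++ jump (2 + L)))))))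
  simplify : ∀ n L → let B′ = suc n + (L + (L + (L + 2))) in
             B′ + (B′ + (B′ + (2 + L + 1))) ≡ 3 * n + 10 * L + 12
  simplify = solve-∀

module _ {n L : ℕ} {S : List ℕ} (|S|≤L : length S ≤ L) where

  private
    infixr 5 _++ʳ_
    _++ʳ_ : ∀ {A : Set} {x : A} xs {ys} → x ∈ ys → x ∈ xs ++ ys
    _++ʳ_ = ∈-++⁺ʳ
    B = basicAlphabet n L
    ins = map inGet (upTo (suc n))
    gets = map auxGet (upTo L)
    sets : Bool → List Basic
    sets b = map (λ i → auxSet i b) (upTo L)
    index∈ : ∀ {i} → i ∷ [] ⊆ S → indexOf S i ∈ upTo L
    index∈ i⊆S = ∈-upTo⁺ (≤-trans (indexOf-< (i⊆S (here refl))) |S|≤L)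

  normalizeBasic-∈ : ∀ a → auxRegister a ⊆ S → normalizeBasic n S a ∈ basicAlphabet n L
  normalizeBasic-∈ (inGet i)        _ = ∈-++⁺ˡ (∈-map⁺ inGet (∈-upTo⁺ (s≤s (m⊓n≤n i n))))
  normalizeBasic-∈ (auxGet i)       a⊆S = ins ++ʳ ∈-++⁺ˡ (∈-map⁺ auxGet (index∈ a⊆S))
  normalizeBasic-∈ (auxSet i true)  a⊆S = ins ++ʳ gets ++ʳ ∈-++⁺ˡ (∈-map⁺ (λ i → auxSet i true) (index∈ a⊆S))
  normalizeBasic-∈ (auxSet i false) a⊆S =
    ins ++ʳ gets ++ʳ sets true ++ʳ ∈-++⁺ˡ (∈-map⁺ (λ i → auxSet i false) (index∈ a⊆S))
  normalizeBasic-∈ (outSet true)    _ = ins ++ʳ gets ++ʳ sets true ++ʳ sets false ++ʳ here refl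
  normalizeBasic-∈ (outSet false)   _ = ins ++ʳ gets ++ʳ sets true ++ʳ sets false ++ʳ there (here refl)

  normalize-∈ : ∀ u → auxRegisters u ⊆ S → normalize n L S u ∈ alphabet n L
  normalize-∈ (plain a) u⊆S = ∈-++⁺ˡ (∈-map⁺ plain (normalizeBasic-∈ a u⊆S))
  normalize-∈ (ptest a) u⊆S = map plain B ++ʳ ∈-++⁺ˡ (∈-map⁺ ptest (normalizeBasic-∈ a u⊆S))
  normalize-∈ (ntest a) u⊆S = map plain B ++ʳ map ptest B ++ʳ ∈-++⁺ˡ (∈-map⁺ ntest (normalizeBasic-∈ a u⊆S))
  normalize-∈ (jump l)  _ =
    map plain B ++ʳ map ptest B ++ʳ map ntest B ++ʳ ∈-++⁺ˡ (∈-map⁺ jump (∈-upTo⁺ (s≤s (m⊓n≤n l (suc L)))))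
  normalize-∈ halt      _ = map plain B ++ʳ map ptest B ++ʳ map ntest B ++ʳ map jump (upTo (2 + L)) ++ʳ here refl

outputOf : Outcome → Bool
outputOf (terminated b) = b
outputOf inaction       = false
outputOf badInput       = false

behaviour : ∀ n → List Prim → Table n
behaviour n us = toTable n (λ bs → outputOf (exec bs (length us) us initState))

table-of-short-program : ∀ {n L f} (X : IS) → len X ≤ L → Computes n X f →
  toTable n f ∈ map (behaviour n) (lists≤ (alphabet n L) L)
table-of-short-program {n} {L} {f} X@(_ ∷ _) |X|≤L X-computes-f =
  subst (_∈ _) same-table (∈-map⁺ (behaviour n) Y∈)
  where
  open ≡-Reasoning
  S = concatMap auxRegisters (toList X)
  Y = map (normalize n L S) (toList X)
  covered = auxRegisters-⊆ (toList X)
  |S|≤L = ≤-trans (length-concatMap-auxRegisters (toList X)) |X|≤L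
  |Y|≡|X| = length-map (normalize n L S) (toList X)
  Y∈ : Y ∈ lists≤ (alphabet n L) L
  Y∈ = ∈-lists≤ L (All.map⁺ (All.map (λ {u} → normalize-∈ |S|≤L u) covered))
                   (≤-trans (≤-reflexive |Y|≡|X|) |X|≤L)
  same-table : behaviour n Y ≡ toTable n f
  same-table = toTable-cong n λ bs → cong outputOf (begin
    exec bs (length Y) Y initState       ≡⟨ cong (λ k → exec bs k Y initState) |Y|≡|X| ⟩
    exec bs (len X) Y initState          ≡⟨ exec-normalize bs S L (len X) (toList X) covered |X|≤L
                                              (refl , λ _ → refl) ⟩
    exec bs (len X) (toList X) initState ≡⟨ X-computes-f bs ⟩
    terminated (f bs)                    ∎)

-- Polynomials against exponentials

2^suc : ∀ n → 2 ^ suc n ≡ 2 ^ n + 2 ^ n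
2^suc n = cong (2 ^ n +_) (+-identityʳ (2 ^ n))

n<2^n : ∀ n → n < 2 ^ n
n<2^n zero    = s≤s z≤n
n<2^n (suc n) = ≤-trans (+-mono-≤ (m^n>0 2 n) (n<2^n n)) (≤-reflexive (sym (2^suc n)))

n+n<2^n : ∀ n → 3 ≤ n → n + n < 2 ^ n
n+n<2^n 1 (s≤s ())
n+n<2^n 2 (s≤s (s≤s ()))
n+n<2^n 3 _ = s≤s (s≤s (s≤s (s≤s (s≤s (s≤s (s≤s z≤n))))))
n+n<2^n (suc n@(suc (suc (suc _)))) _ = begin-strict
  suc n + suc n     ≡⟨ cong suc (+-suc n n) ⟩
  2 + (n + n)       <⟨ +-monoʳ-< 2 (n+n<2^n n (s≤s (s≤s (s≤s z≤n)))) ⟩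
  2 + 2 ^ n         ≤⟨ +-monoˡ-≤ (2 ^ n) (^-monoʳ-≤ 2 {1} {n} (s≤s z≤n)) ⟩
  2 ^ n + 2 ^ n     ≡⟨ sym (2^suc n) ⟩
  2 ^ suc n         ∎
  where open ≤-Reasoning

evalPoly-≤ : ∀ cs {c n} → sum cs ≤ c → evalPoly cs n ≤ (suc c * suc n) ^ length cs
evalPoly-≤ []       _       = z≤n
evalPoly-≤ (c′ ∷ cs) {c} {n} c′+Σ≤c = begin
  c′ + n * evalPoly cs n  ≤⟨ +-mono-≤ (≤-trans (m+n≤o⇒m≤o c′ c′+Σ≤c) (m≤m*n c X))
                                       (*-monoʳ-≤ n (evalPoly-≤ cs (m+n≤o⇒n≤o c′ c′+Σ≤c))) ⟩
  c * X + n * X           ≤⟨ m≤m+n (c * X + n * X) (X + c * n * X) ⟩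
  (c * X + n * X) + (X + c * n * X) ≡⟨ expand c n X ⟩
  (suc c * suc n) * X     ∎
  where
  open ≤-Reasoning
  X = (suc c * suc n) ^ length cs
  instance _ = m^n≢0 (suc c * suc n) (length cs)
  expand : ∀ c n X → (c * X + n * X) + (X + c * n * X) ≡ (suc c * suc n) * X
  expand = solve-∀

polynomial-below-2^ : ∀ cs → ∃[ m ] 4 ≤ m × evalPoly cs (m + m) ≤ 2 ^ m
polynomial-below-2^ cs = m , ^-monoʳ-≤ 2 (≤-trans (≤-trans (n≤1+n 2) (m≤n+m 3 (a + d))) (<⇒≤ t<j)) , (begin
  evalPoly cs (m + m)    ≤⟨ evalPoly-≤ cs ≤-refl ⟩
  (a * suc (m + m)) ^ d  ≤⟨ ^-monoˡ-≤ d base≤2^e ⟩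
  (2 ^ e) ^ d            ≡⟨ ^-*-assoc 2 e d ⟩
  2 ^ (e * d)            ≤⟨ ^-monoʳ-≤ 2 e*d≤m ⟩
  2 ^ m                  ∎)
  where
  open ≤-Reasoning
  a = suc (sum cs)
  d = length cs
  t = a + d + 3
  j = 2 ^ t
  m = 2 ^ j
  e = a + (2 + j)
  t<j : t < j
  t<j = n<2^n t
  base≤2^e : a * suc (m + m) ≤ 2 ^ e
  base≤2^e = begin
    a * suc (m + m)         ≤⟨ *-monoˡ-≤ (suc (m + m)) (<⇒≤ (n<2^n a)) ⟩
    2 ^ a * suc (m + m)     ≤⟨ *-monoʳ-≤ (2 ^ a) (+-monoˡ-≤ (m + m) (≤-trans (m^n>0 2 j) (m≤m+n m m))) ⟩
    2 ^ a * ((m + m) + (m + m)) ≡⟨ cong (2 ^ a *_) (quadruple m) ⟩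
    2 ^ a * 2 ^ (2 + j)     ≡⟨ sym (^-distribˡ-+-* 2 a (2 + j)) ⟩
    2 ^ e                   ∎
    where
    quadruple : ∀ m → (m + m) + (m + m) ≡ 2 * (2 * m)
    quadruple = solve-∀
  e≤j+j : e ≤ j + j
  e≤j+j = begin
    a + (2 + j)        ≡⟨ sym (+-assoc a 2 j) ⟩
    (a + 2) + j        ≤⟨ +-monoˡ-≤ j (m≤m+n (a + 2) (d + 1)) ⟩
    (a + 2) + (d + 1) + j ≡⟨ cong (_+ j) (sym (t≡ a d)) ⟩
    t + j              ≤⟨ +-monoˡ-≤ j (<⇒≤ t<j) ⟩
    j + j              ∎
    where
    t≡ : ∀ a d → a + d + 3 ≡ (a + 2) + (d + 1)
    t≡ = solve-∀
  e*d≤m : e * d ≤ m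
  e*d≤m = begin
    e * d                ≤⟨ *-mono-≤ e≤j+j (<⇒≤ (n<2^n d)) ⟩
    (j + j) * 2 ^ d      ≡⟨ cong (_* 2 ^ d) (sym (2^suc t)) ⟩
    2 ^ suc t * 2 ^ d    ≡⟨ sym (^-distribˡ-+-* 2 (suc t) d) ⟩
    2 ^ (suc t + d)      ≤⟨ ^-monoʳ-≤ 2 (begin
      suc t + d              ≤⟨ m≤m+n (suc t + d) (a + 2) ⟩
      suc t + d + (a + 2)    ≡⟨ t+t≡ a d ⟩
      t + t                  ≤⟨ <⇒≤ (n+n<2^n t (m≤n+m 3 (a + d))) ⟩
      j                      ∎) ⟩
    2 ^ j                ∎
    where
    t+t≡ : ∀ a d → suc (a + d + 3) + d + (a + 2) ≡ (a + d + 3) + (a + d + 3)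
    t+t≡ = solve-∀

suc-length-alphabet≤ : ∀ m → 4 ≤ m → suc (length (alphabet (m + m) (2 ^ m))) ≤ 2 ^ m * 2 ^ m
suc-length-alphabet≤ m 4≤m = begin
  suc (length (alphabet (m + m) x)) ≡⟨ cong suc (length-alphabet (m + m) x) ⟩
  suc (3 * (m + m) + 10 * x + 12)   ≡⟨ shift (m + m) x ⟩
  3 * (m + m) + 10 * x + 13         ≤⟨ +-mono-≤ (+-monoˡ-≤ (10 * x) (*-monoʳ-≤ 3 m+m≤x))
                                                 (≤-trans (m≤m+n 13 3) 16≤x) ⟩
  3 * x + 10 * x + x                ≡⟨ collect x ⟩
  14 * x                            ≤⟨ *-monoˡ-≤ x (≤-trans (m≤m+n 14 2) 16≤x) ⟩
  x * x                             ∎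
  where
  open ≤-Reasoning
  x = 2 ^ m
  16≤x = ^-monoʳ-≤ 2 4≤m
  m+m≤x = <⇒≤ (n+n<2^n m (≤-trans (n≤1+n 3) 4≤m))
  shift : ∀ k x → suc (3 * k + 10 * x + 12) ≡ 3 * k + 10 * x + 13
  shift = solve-∀
  collect : ∀ x → 3 * x + 10 * x + x ≡ 14 * x
  collect = solve-∀

-- The diagonal family

-- Eventually above every polynomial, yet admitting fewer programs than there
-- are truth tables.
lengthBound : ℕ → ℕ
lengthBound N = 2 ^ ⌊ N /2⌋

shortProgramTables : (N : ℕ) → List (Table N)
shortProgramTables N = map (behaviour N) (lists≤ (alphabet N (lengthBound N)) (lengthBound N))

diagonal : Family
diagonal N = fromTable N (avoid (2 ^ N) (shortProgramTables N))

short-programs-miss-diagonal : ∀ N → length (shortProgramTables N) < 2 ^ 2 ^ N →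
  (X : IS) → len X ≤ lengthBound N → ¬ Computes N X (diagonal N)
short-programs-miss-diagonal N few X |X|≤L X-computes = avoid-∉ (2 ^ N) few
  (subst (_∈ shortProgramTables N) (toTable-fromTable N _) (table-of-short-program X |X|≤L X-computes))

lengthBound-double : ∀ m → lengthBound (m + m) ≡ 2 ^ m
lengthBound-double m = cong (2 ^_) (sym (n≡⌊n+n/2⌋ m))

length-shortProgramTables< : ∀ m → 4 ≤ m → length (shortProgramTables (m + m)) < 2 ^ 2 ^ (m + m)
length-shortProgramTables< m 4≤m = begin-strict
  length (shortProgramTables N)      ≡⟨ length-map (behaviour N) (lists≤ (alphabet N L) L) ⟩
  length (lists≤ (alphabet N L) L)   ≤⟨ length-lists≤ (alphabet N L) L ⟩
  suc (length (alphabet N L)) ^ L    ≡⟨ cong (λ L → suc (length (alphabet N L)) ^ L) (lengthBound-double m) ⟩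
  suc (length (alphabet N x)) ^ x    ≤⟨ ^-monoˡ-≤ x (suc-length-alphabet≤ m 4≤m) ⟩
  (x * x) ^ x                        ≡⟨ cong (_^ x) (sym (^-distribˡ-+-* 2 m m)) ⟩
  (2 ^ N) ^ x                        ≡⟨ ^-*-assoc 2 N x ⟩
  2 ^ (N * x)                        <⟨ ^-monoʳ-< 2 (s≤s (s≤s z≤n))
                                          (*-monoˡ-< x {{m^n≢0 2 m}} (n+n<2^n m (≤-trans (n≤1+n 3) 4≤m))) ⟩
  2 ^ (x * x)                        ≡⟨ cong (2 ^_) (sym (^-distribˡ-+-* 2 m m)) ⟩
  2 ^ 2 ^ N                          ∎
  where
  open ≤-Reasoning
  N = m + m
  L = lengthBound N
  x = 2 ^ m

diagonal∉P-IS : ¬ P-IS diagonal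
diagonal∉P-IS (h , (cs , h≡p) , programs) with polynomial-below-2^ cs
... | m , 4≤m , p≤2^m with programs (m + m)
...   | X , |X|≤h , X-computes =
  short-programs-miss-diagonal (m + m) (length-shortProgramTables< m 4≤m) X |X|≤L X-computes
  where
  open ≤-Reasoning
  |X|≤L : len X ≤ lengthBound (m + m)
  |X|≤L = begin
    len X                 ≤⟨ |X|≤h ⟩
    h (m + m)             ≡⟨ h≡p (m + m) ⟩
    evalPoly cs (m + m)   ≤⟨ p≤2^m ⟩
    2 ^ m                 ≡⟨ lengthBound-double m ⟨
    lengthBound (m + m)   ∎

corollary3 : P-IS ⊊ IS-O2^n
corollary3 = (λ fam _ → IS-O2^n-universal fam) , diagonal , IS-O2^n-universal diagonal , diagonal∉P-IS
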